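{- Let $a,b$ be positive integers. Then \[ \mathrm{Inc}^{a+b}(a\times b) = \mathrm{Inc}_{\mathrm{Packed}}^{a+b}(a\times b) \sqcup \mathcal{E}, \] where $\mathcal{E}$ is the orbit under $\mathrm{KPro}$ of the tableau $T_0$ given by $T_0(i,j) = i+j-1$ (for $1\le i\le a$, $1\le j\le b$, with $(1,1)$ the upper-left cell), and $|\mathcal{E}| = a+b$.
   Context: An increasing tableau of shape $\lambda$ is a filling of the Young diagram of $\lambda$ with positive integers strictly increasing along rows and down columns; $\mathrm{Inc}^m(\lambda)$ is the set of such tableaux with all entries at most $m$. A tableau $T$ is packed if every value $1,\ldots,\max(T)$ appears; $\mathrm{Inc}_{\mathrm{Packed}}^m(\lambda)$ is the set of packed increasing tableaux of shape $\lambda$ with maximum entry exactly $m$. $a\times b$ is the rectangular partition with $a$ rows of length $b$. K-promotion $\mathrm{KPro}$ on $\mathrm{Inc}^m(\lambda)$ (here $m=a+b$): given $T$, delete the entry $1$ (if present), leaving empty cells. The southeast neighbors of a cell are the (at most two) cells immediately to its right and immediately below it. Repeatedly, simultaneously for all empty cells, until no empty cell has a southeast neighbor: label each empty cell by the minimal label among its southeast neighbors and remove that label from each southeast neighbor containing it; an empty cell with no southeast neighbors stays unchanged. Finally label all empty cells by $m+1$ and subtract $1$ from every label to get $\mathrm{KPro}(T)$. -}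

module Defs where

open import Data.Nat using (ℕ; zero; suc; _+_; _∸_; _≤_; _<_; _⊔_; _⊓_; _≡ᵇ_; _<?_)
open import Data.Fin using (Fin; toℕ; fromℕ<; inject₁)
open import Data.Vec using (Vec; lookup; tabulate; map; foldr′)
open import Data.Maybe using (Maybe; just; nothing)
open import Data.Product using (_×_; _,_; ∃; ∃-syntax)
open import Data.Bool using (Bool; true; false; if_then_else_; _∨_; _∧_)
open import Relation.Nullary using (yes; no)
open import Relation.Binary.PropositionalEquality using (_≡_)

-- A filling of the a×b rectangle: row i (0-indexed, top row first), column j
-- (0-indexed, leftmost first).  Cell (i,j) here is cell (i+1,j+1) of the paper.
Tab : ℕ → ℕ → Set
Tab a b = Vec (Vec ℕ b) a

entry : ∀ {a b} → Tab a b → Fin a → Fin b → ℕ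
entry T i j = lookup (lookup T i) j

IsInc : ∀ {a b} → ℕ → Tab a b → Set
IsInc {a} {b} m T =
  (∀ i j → 1 ≤ entry T i j × entry T i j ≤ m)
  × (∀ i j j′ → toℕ j < toℕ j′ → entry T i j < entry T i j′)
  × (∀ i i′ j → toℕ i < toℕ i′ → entry T i j < entry T i′ j)

maxEntry : ∀ {a b} → Tab a b → ℕ
maxEntry T = foldr′ _⊔_ 0 (map (foldr′ _⊔_ 0) T)

IsPacked : ∀ {a b} → Tab a b → Set
IsPacked {a} {b} T = ∀ v → 1 ≤ v → v ≤ maxEntry T → ∃[ i ] ∃[ j ] entry T i j ≡ v

IsPackedInc : ∀ {a b} → ℕ → Tab a b → Set
IsPackedInc m T = IsInc m T × IsPacked T × maxEntry T ≡ m

next : ∀ {n} → Fin n → Maybe (Fin n)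
next {n} i with suc (toℕ i) <? n
... | yes p = just (fromℕ< p)
... | no _  = nothing

prev : ∀ {n} → Fin n → Maybe (Fin n)
prev Fin.zero    = nothing
prev (Fin.suc i) = just (inject₁ i)

-- intermediate states: nothing = empty cell, just v = cell labelled v
State : ℕ → ℕ → Set
State a b = Vec (Vec (Maybe ℕ) b) a

get : ∀ {a b} → State a b → Fin a → Fin b → Maybe ℕ
get S i j = lookup (lookup S i) j

getM : ∀ {a b} → State a b → Maybe (Fin a × Fin b) → Maybe ℕ
getM S nothing        = nothing
getM S (just (i , j)) = get S i j

rightOf : ∀ {a b} → Fin a → Fin b → Maybe (Fin a × Fin b)
rightOf i j with next j
... | just j′ = just (i , j′)
... | nothing = nothing

below : ∀ {a b} → Fin a → Fin b → Maybe (Fin a × Fin b)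
below i j with next i
... | just i′ = just (i′ , j)
... | nothing = nothing

leftOf : ∀ {a b} → Fin a → Fin b → Maybe (Fin a × Fin b)
leftOf i j with prev j
... | just j′ = just (i , j′)
... | nothing = nothing

above : ∀ {a b} → Fin a → Fin b → Maybe (Fin a × Fin b)
above i j with prev i
... | just i′ = just (i′ , j)
... | nothing = nothing

minM : Maybe ℕ → Maybe ℕ → Maybe ℕ
minM nothing  y        = y
minM (just x) nothing  = just x
minM (just x) (just y) = just (x ⊓ y)

newLabel : ∀ {a b} → State a b → Fin a → Fin b → Maybe ℕ
newLabel S i j = minM (getM S (rightOf i j)) (getM S (below i j))

takesFrom : ∀ {a b} → State a b → Maybe (Fin a × Fin b) → ℕ → Bool
takesFrom S nothing        v = false
takesFrom S (just (i , j)) v with get S i j | newLabel S i j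
... | nothing | just w = w ≡ᵇ v
... | _       | _      = false

step : ∀ {a b} → State a b → State a b
step S = tabulate λ i → tabulate λ j → cell i j (get S i j)
  where
  cell : _ → _ → Maybe ℕ → Maybe ℕ
  cell i j nothing  = newLabel S i j
  cell i j (just v) =
    if takesFrom S (leftOf i j) v ∨ takesFrom S (above i j) v then nothing else just v

iter : ∀ {A : Set} → (A → A) → ℕ → A → A
iter f zero    x = x
iter f (suc k) x = f (iter f k x)

-- Every empty cell moves strictly southeast at each step
-- (i+j increases by 1), so after a+b steps no empty cell has a labelled
-- southeast neighbour; further steps leave the state unchanged.
KPro : ∀ {a b} → ℕ → Tab a b → Tab a b
KPro {a} {b} m T = map (map fin) (iter step (a + b) S₀)
  where
  S₀ : State _ _
  S₀ = map (map λ x → if x ≡ᵇ 1 then nothing else just x) T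
  fin : Maybe ℕ → ℕ
  fin nothing  = m          -- label m+1, then subtract 1
  fin (just v) = v ∸ 1

T₀ : (a b : ℕ) → Tab a b
T₀ a b = tabulate λ i → tabulate λ j → toℕ i + toℕ j + 1

InOrbit : (a b : ℕ) → Tab a b → Set
InOrbit a b T = ∃[ k ] iter (KPro (a + b)) k (T₀ a b) ≡ T

{-# OPTIONS --safe #-}
-- Index the antidiagonals of the a×b rectangle by d = i+j ∈ [0, a+b-2].  Entries of an
-- increasing tableau grow by at least one from each antidiagonal to the next, so with
-- entries in [1, a+b] the entry on antidiagonal d is d+1 or d+2.  Following neighbours
-- back to the corner, an entry d+1 forces all of 1,…,d+1 to occur; following them forward,
-- an entry d+2 forces all of d+2,…,a+b.  Hence if v is missing, the tableau is Gap v, whose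
-- antidiagonal d carries the (d+1)-st positive integer other than v; and T₀ = Gap (a+b).
-- In Gap (v+1) the label 1 sits in the corner alone; K-promotion empties it and the hole
-- then slides forward one antidiagonal per step, so every label moves back one
-- antidiagonal and drops by one: KPro (Gap (v+1)) = Gap v.  Gap 1 has no label 1, so
-- KPro only lowers its labels, giving Gap (a+b).
module Submission where

open import Data.Bool using (Bool; true; false; if_then_else_; _∨_)
open import Data.Empty using (⊥-elim)
open import Data.Fin using (Fin; zero; suc; toℕ; fromℕ; fromℕ<; inject₁)
open import Data.Fin.Properties
  using (toℕ-fromℕ; toℕ-fromℕ<; toℕ-inject₁; toℕ<n; toℕ-injective; all?; any?; ¬∀⟶∃¬)
open import Data.List using (List; length; tabulate)
open import Data.List.Membership.Propositional using (_∈_)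
open import Data.List.Membership.Propositional.Properties using (∈-tabulate⁺; ∈-tabulate⁻)
open import Data.List.Properties using (length-tabulate)
open import Data.List.Relation.Unary.Unique.Propositional using (Unique)
open import Data.List.Relation.Unary.Unique.Propositional.Properties using (tabulate⁺)
open import Data.Maybe using (Maybe; just; nothing)
open import Data.Nat using (ℕ; zero; suc; _+_; _∸_; _≤_; _<_; _⊔_; _≡ᵇ_; z≤n; s≤s; _≤?_; _<?_; _≟_)
open import Data.Nat.Properties
open import Data.Nat.Solver using (module +-*-Solver)
open import Data.Product using (∃; ∃-syntax; _×_; _,_; proj₁; proj₂)
open import Data.Sum using (_⊎_; inj₁; inj₂; map₂)
open import Data.Vec using (Vec; lookup; map; foldr′)
import Data.Vec as Vec
open import Data.Vec.Properties using (lookup∘tabulate; lookup-map; tabulate∘lookup; tabulate-cong)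
open import Function.Bundles using (_⇔_; mk⇔; Equivalence)
open import Relation.Binary.Definitions using (Tri; tri<; tri≈; tri>)
open import Relation.Binary.PropositionalEquality
open import Relation.Nullary using (¬_; Dec; yes; no)

open import Defs

lookup-tabulate² : ∀ {A : Set} {a b} (F : Fin a → Fin b → A) i j →
  lookup (lookup (Vec.tabulate λ i → Vec.tabulate (F i)) i) j ≡ F i j
lookup-tabulate² F i j rewrite lookup∘tabulate (λ i → Vec.tabulate (F i)) i = lookup∘tabulate (F i) j

lookup-map² : ∀ {A B : Set} {a b} (h : A → B) (X : Vec (Vec A b) a) i j →
  lookup (lookup (map (map h) X) i) j ≡ h (lookup (lookup X i) j)
lookup-map² h X i j rewrite lookup-map i (map h) X = lookup-map j h (lookup X i)

lookup-ext : ∀ {A : Set} {n} {xs ys : Vec A n} → (∀ i → lookup xs i ≡ lookup ys i) → xs ≡ ys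
lookup-ext {xs = xs} {ys} eq =
  trans (sym (tabulate∘lookup xs)) (trans (tabulate-cong eq) (tabulate∘lookup ys))

entry-ext : ∀ {a b} {T U : Tab a b} → (∀ i j → entry T i j ≡ entry U i j) → T ≡ U
entry-ext eq = lookup-ext λ i → lookup-ext (eq i)

foldr⊔-lub : ∀ {n} (xs : Vec ℕ n) {M} → (∀ i → lookup xs i ≤ M) → foldr′ _⊔_ 0 xs ≤ M
foldr⊔-lub Vec.[]       le = z≤n
foldr⊔-lub (x Vec.∷ xs) le = ⊔-lub (le zero) (foldr⊔-lub xs (λ i → le (suc i)))

foldr⊔-upper : ∀ {n} (xs : Vec ℕ n) i → lookup xs i ≤ foldr′ _⊔_ 0 xs
foldr⊔-upper (x Vec.∷ xs) zero    = m≤m⊔n x _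
foldr⊔-upper (x Vec.∷ xs) (suc i) = ≤-trans (foldr⊔-upper xs i) (m≤n⊔m x _)

maxEntry-lub : ∀ {a b} (T : Tab a b) {M} → (∀ i j → entry T i j ≤ M) → maxEntry T ≤ M
maxEntry-lub T {M} le = foldr⊔-lub (map (foldr′ _⊔_ 0) T) λ i →
  subst (_≤ M) (sym (lookup-map i (foldr′ _⊔_ 0) T)) (foldr⊔-lub (lookup T i) (le i))

entry≤maxEntry : ∀ {a b} (T : Tab a b) i j → entry T i j ≤ maxEntry T
entry≤maxEntry T i j = begin
  entry T i j                            ≤⟨ foldr⊔-upper (lookup T i) j ⟩
  foldr′ _⊔_ 0 (lookup T i)              ≡⟨ lookup-map i (foldr′ _⊔_ 0) T ⟨
  lookup (map (foldr′ _⊔_ 0) T) i        ≤⟨ foldr⊔-upper (map (foldr′ _⊔_ 0) T) i ⟩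
  maxEntry T                             ∎
  where open ≤-Reasoning

Occurs : ∀ {a b} → Tab a b → ℕ → Set
Occurs T v = ∃[ i ] ∃[ j ] entry T i j ≡ v

increasing⇒+-≤ : ∀ {n} (f : Fin n → ℕ) → (∀ x y → toℕ x < toℕ y → f x < f y) →
  ∀ k {x y} → toℕ y ≡ toℕ x + k → f x + k ≤ f y
increasing⇒+-≤ f inc zero {x} {y} eq
  rewrite +-identityʳ (f x) | toℕ-injective (trans eq (+-identityʳ (toℕ x))) = ≤-refl
increasing⇒+-≤ {n} f inc (suc k) {x} {y} eq = begin
  f x + suc k ≡⟨ +-suc (f x) k ⟩
  suc (f x + k) ≤⟨ s≤s (increasing⇒+-≤ f inc k (toℕ-fromℕ< z<n)) ⟩
  suc (f z)     ≤⟨ inc z y (subst₂ _<_ (sym (toℕ-fromℕ< z<n)) (sym y≡1+z) ≤-refl) ⟩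
  f y           ∎
  where
  open ≤-Reasoning
  y≡1+z : toℕ y ≡ suc (toℕ x + k)
  y≡1+z = trans eq (+-suc (toℕ x) k)
  z<n : toℕ x + k < n
  z<n = <-trans (n<1+n _) (subst (_< n) y≡1+z (toℕ<n y))
  z : Fin n
  z = fromℕ< z<n

claimed : ∀ {a b} → State a b → Fin a → Fin b → ℕ → Bool
claimed S i j v = takesFrom S (leftOf i j) v ∨ takesFrom S (above i j) v

-- The cell function of `step` is local to its definition; this gives it a name.
step-tabulated : ∀ {a b} (S : State a b) →
  ∃ λ (F : Fin a → Fin b → Maybe ℕ) → step S ≡ Vec.tabulate λ i → Vec.tabulate (F i)
step-tabulated S = _ , refl

get-step : ∀ {a b} (S : State a b) i j → get (step S) i j ≡ proj₁ (step-tabulated S) i j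
get-step S i j = lookup-tabulate² (proj₁ (step-tabulated S)) i j

get-step-empty : ∀ {a b} (S : State a b) i j → get S i j ≡ nothing → get (step S) i j ≡ newLabel S i j
get-step-empty S i j e rewrite get-step S i j | e = refl

get-step-labelled : ∀ {a b} (S : State a b) i j {v} → get S i j ≡ just v →
  get (step S) i j ≡ (if claimed S i j v then nothing else just v)
get-step-labelled S i j e rewrite get-step S i j | e = refl

≡ᵇ-refl : ∀ v → (v ≡ᵇ v) ≡ true
≡ᵇ-refl zero    = refl
≡ᵇ-refl (suc v) = ≡ᵇ-refl v

takesFrom-empty : ∀ {a b} (S : State a b) i j {v} → get S i j ≡ nothing → newLabel S i j ≡ just v →
  takesFrom S (just (i , j)) v ≡ true
takesFrom-empty S i j {v} e e′ with get S i j | newLabel S i j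
takesFrom-empty S i j {v} refl refl | nothing | just v = ≡ᵇ-refl v

takesFrom-labelled : ∀ {a b} (S : State a b) i j {v x} → get S i j ≡ just x →
  takesFrom S (just (i , j)) v ≡ false
takesFrom-labelled S i j e with get S i j
takesFrom-labelled S i j refl | just x = refl

minM-idem : ∀ x → minM x x ≡ x
minM-idem nothing  = refl
minM-idem (just x) = cong just (⊓-idem x)

minM-identityʳ : ∀ x → minM x nothing ≡ x
minM-identityʳ nothing  = refl
minM-identityʳ (just x) = refl

rightOf-cases : ∀ {a b} (i : Fin a) (j : Fin b) →
  (∃[ j′ ] rightOf i j ≡ just (i , j′) × toℕ j′ ≡ suc (toℕ j)) ⊎ (rightOf i j ≡ nothing × b ≤ suc (toℕ j))
rightOf-cases {b = b} i j with suc (toℕ j) <? b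
... | yes lt = inj₁ (fromℕ< lt , refl , toℕ-fromℕ< lt)
... | no ¬lt = inj₂ (refl , ≮⇒≥ ¬lt)

below-cases : ∀ {a b} (i : Fin a) (j : Fin b) →
  (∃[ i′ ] below i j ≡ just (i′ , j) × toℕ i′ ≡ suc (toℕ i)) ⊎ (below i j ≡ nothing × a ≤ suc (toℕ i))
below-cases {a = a} i j with suc (toℕ i) <? a
... | yes lt = inj₁ (fromℕ< lt , refl , toℕ-fromℕ< lt)
... | no ¬lt = inj₂ (refl , ≮⇒≥ ¬lt)

unlabelOne : ℕ → Maybe ℕ
unlabelOne x = if x ≡ᵇ 1 then nothing else just x

unlabelOne-≥2 : ∀ {x} → 2 ≤ x → unlabelOne x ≡ just x
unlabelOne-≥2 (s≤s (s≤s _)) = refl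

initialState : ∀ {a b} → Tab a b → State a b
initialState = map (map unlabelOne)

finalLabel : ℕ → Maybe ℕ → ℕ
finalLabel m nothing  = m
finalLabel m (just v) = v ∸ 1

-- The relabelling at the end of `KPro` is local to its definition; this gives it a name.
KPro-run : ∀ {a b} m (T : Tab a b) → ∃ λ (finish : Maybe ℕ → ℕ) →
  KPro m T ≡ map (map finish) (iter step (a + b) (initialState T)) × (∀ x → finish x ≡ finalLabel m x)
KPro-run m T = _ , refl , λ { nothing → refl ; (just v) → refl }

KPro-entry : ∀ {a b} m (T : Tab a b) i j →
  entry (KPro m T) i j ≡ finalLabel m (get (iter step (a + b) (initialState T)) i j)
KPro-entry {a} {b} m T i j with KPro-run m T
... | finish , eq , finish≗ = trans (cong (λ U → entry U i j) eq)
  (trans (lookup-map² finish (iter step (a + b) (initialState T)) i j) (finish≗ _))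

Labelled : Maybe ℕ → Set
Labelled y = ∃[ x ] y ≡ just x

-- Labels by antidiagonal while the hole sits on antidiagonal n: the labels before the
-- hole have already been pulled back by one antidiagonal.
holeAt : (ℕ → ℕ) → ℕ → ℕ → Maybe ℕ
holeAt f n d with <-cmp d n
... | tri< _ _ _ = just (f (suc d))
... | tri≈ _ _ _ = nothing
... | tri> _ _ _ = just (f d)

holeAt-< : ∀ f {n d} → d < n → holeAt f n d ≡ just (f (suc d))
holeAt-< f {n} {d} d<n with <-cmp d n
... | tri< _ _ _    = refl
... | tri≈ ¬d<n _ _ = ⊥-elim (¬d<n d<n)
... | tri> ¬d<n _ _ = ⊥-elim (¬d<n d<n)

holeAt-self : ∀ f n → holeAt f n n ≡ nothing
holeAt-self f n with <-cmp n n
... | tri< _ n≢n _ = ⊥-elim (n≢n refl)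
... | tri≈ _ _ _   = refl
... | tri> _ n≢n _ = ⊥-elim (n≢n refl)

holeAt-> : ∀ f {n d} → n < d → holeAt f n d ≡ just (f d)
holeAt-> f {n} {d} n<d with <-cmp d n
... | tri< _ _ ¬n<d = ⊥-elim (¬n<d n<d)
... | tri≈ _ _ ¬n<d = ⊥-elim (¬n<d n<d)
... | tri> _ _ _    = refl

holeAt-before-labelled : ∀ f {n d} → d ≢ suc n → ∀ k → suc k ≡ d → Labelled (holeAt f n k)
holeAt-before-labelled f {n} d≢1+n k e with <-cmp k n
... | tri< _ _ _   = _ , refl
... | tri≈ _ k≡n _ = ⊥-elim (d≢1+n (trans (sym e) (cong suc k≡n)))
... | tri> _ _ _   = _ , refl

skipping : ℕ → ℕ → ℕ
skipping c d with c ≤? suc d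
... | yes _ = suc (suc d)
... | no _  = suc d

skipping-above : ∀ {c d} → c ≤ suc d → skipping c d ≡ suc (suc d)
skipping-above {c} {d} c≤1+d with c ≤? suc d
... | yes _ = refl
... | no c≰1+d = ⊥-elim (c≰1+d c≤1+d)

skipping-below : ∀ {c d} → suc d < c → skipping c d ≡ suc d
skipping-below {c} {d} 1+d<c with c ≤? suc d
... | yes c≤1+d = ⊥-elim (<⇒≱ 1+d<c c≤1+d)
... | no _ = refl

skipping-suc : ∀ c d → skipping (suc c) (suc d) ≡ suc (skipping c d)
skipping-suc c d with c ≤? suc d
... | yes c≤1+d = skipping-above (s≤s c≤1+d)
... | no c≰1+d  = skipping-below (s≤s (≰⇒> c≰1+d))

skipping-lower : ∀ c d → suc d ≤ skipping c d
skipping-lower c d with c ≤? suc d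
... | yes _ = n≤1+n (suc d)
... | no _  = ≤-refl

skipping-upper : ∀ c d → skipping c d ≤ suc (suc d)
skipping-upper c d with c ≤? suc d
... | yes _ = ≤-refl
... | no _  = n≤1+n (suc d)

skipping-≢ : ∀ c d → skipping c d ≢ c
skipping-≢ c d eq with c ≤? suc d
... | yes c≤1+d = <-irrefl (sym eq) (s≤s c≤1+d)
... | no c≰1+d  = c≰1+d (≤-reflexive (sym eq))

skipping-strictMono : ∀ c {d d′} → d < d′ → skipping c d < skipping c d′
skipping-strictMono c {d} {d′} d<d′ with c ≤? suc d | c ≤? suc d′
... | yes _     | yes _       = s≤s (s≤s d<d′)
... | yes c≤1+d | no c≰1+d′   = ⊥-elim (c≰1+d′ (≤-trans c≤1+d (s≤s (<⇒≤ d<d′))))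
... | no _      | yes _       = s≤s (<⇒≤ (s≤s d<d′))
... | no _      | no _        = s≤s d<d′

module Rectangle (a′ b′ : ℕ) where

  a b m lastDiag : ℕ
  a = suc a′
  b = suc b′
  m = a + b
  lastDiag = a′ + b′

  m≡2+lastDiag : m ≡ suc (suc lastDiag)
  m≡2+lastDiag = cong suc (+-suc a′ b′)

  diag : Fin a → Fin b → ℕ
  diag i j = toℕ i + toℕ j

  toℕ≤a′ : (i : Fin a) → toℕ i ≤ a′
  toℕ≤a′ i = ≤-pred (toℕ<n i)

  toℕ≤b′ : (j : Fin b) → toℕ j ≤ b′
  toℕ≤b′ j = ≤-pred (toℕ<n j)

  diag≤lastDiag : ∀ i j → diag i j ≤ lastDiag
  diag≤lastDiag i j = +-mono-≤ (toℕ≤a′ i) (toℕ≤b′ j)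

  1+diag<m : ∀ i j → suc (diag i j) < m
  1+diag<m i j = subst (suc (diag i j) <_) (sym m≡2+lastDiag) (s≤s (s≤s (diag≤lastDiag i j)))

  diag-left : ∀ i j → suc (diag i (inject₁ j)) ≡ diag i (suc j)
  diag-left i j = trans (cong (λ t → suc (toℕ i + t)) (toℕ-inject₁ j)) (sym (+-suc (toℕ i) (toℕ j)))

  diag-above : ∀ i j → suc (diag (inject₁ i) j) ≡ diag (suc i) j
  diag-above i j = cong (λ t → suc (t + toℕ j)) (toℕ-inject₁ i)

  diag-surjective : ∀ {d} → d ≤ lastDiag → ∃[ i ] ∃[ j ] diag i j ≡ d
  diag-surjective {d} d≤N with d ≤? a′
  ... | yes d≤a′ = fromℕ< (s≤s d≤a′) , zero , trans (+-identityʳ _) (toℕ-fromℕ< (s≤s d≤a′))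
  ... | no d≰a′  = fromℕ a′ , fromℕ< (s≤s d∸a′≤b′) , (begin
    toℕ (fromℕ a′) + toℕ (fromℕ< (s≤s d∸a′≤b′)) ≡⟨ cong₂ _+_ (toℕ-fromℕ a′) (toℕ-fromℕ< (s≤s d∸a′≤b′)) ⟩
    a′ + (d ∸ a′)                               ≡⟨ m+[n∸m]≡n (<⇒≤ (≰⇒> d≰a′)) ⟩
    d                                           ∎)
    where
    open ≡-Reasoning
    d∸a′≤b′ : d ∸ a′ ≤ b′
    d∸a′≤b′ = m≤n+o⇒m∸n≤o d a′ d≤N

  record Diagonal (S : State a b) (g : ℕ → Maybe ℕ) : Set where
    field onDiag : ∀ i j → get S i j ≡ g (diag i j)
  open Diagonal

  module _ {S : State a b} {g : ℕ → Maybe ℕ} (D : Diagonal S g) where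

    getM-rightOf : ∀ i j →
      (getM S (rightOf i j) ≡ g (suc (diag i j)) × toℕ j < b′) ⊎ (getM S (rightOf i j) ≡ nothing × toℕ j ≡ b′)
    getM-rightOf i j with rightOf-cases i j
    ... | inj₁ (j′ , eq , j′≡1+j) rewrite eq =
      inj₁ (trans (onDiag D i j′) (cong g (trans (cong (toℕ i +_) j′≡1+j) (+-suc (toℕ i) (toℕ j))))
           , subst (_≤ b′) j′≡1+j (toℕ≤b′ j′))
    ... | inj₂ (eq , b≤1+j) rewrite eq = inj₂ (refl , ≤-antisym (toℕ≤b′ j) (≤-pred b≤1+j))

    getM-below : ∀ i j →
      (getM S (below i j) ≡ g (suc (diag i j)) × toℕ i < a′) ⊎ (getM S (below i j) ≡ nothing × toℕ i ≡ a′)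
    getM-below i j with below-cases i j
    ... | inj₁ (i′ , eq , i′≡1+i) rewrite eq =
      inj₁ (trans (onDiag D i′ j) (cong g (cong (_+ toℕ j) i′≡1+i)) , subst (_≤ a′) i′≡1+i (toℕ≤a′ i′))
    ... | inj₂ (eq , a≤1+i) rewrite eq = inj₂ (refl , ≤-antisym (toℕ≤a′ i) (≤-pred a≤1+i))

    newLabel-inner : ∀ i j → diag i j < lastDiag → newLabel S i j ≡ g (suc (diag i j))
    newLabel-inner i j d<N with getM-rightOf i j | getM-below i j
    ... | inj₁ (r , _) | inj₁ (u , _) rewrite r | u = minM-idem _
    ... | inj₁ (r , _) | inj₂ (u , _) rewrite r | u = minM-identityʳ _
    ... | inj₂ (r , _) | inj₁ (u , _) rewrite r | u = refl
    ... | inj₂ (_ , j≡b′) | inj₂ (_ , i≡a′) = ⊥-elim (<-irrefl (cong₂ _+_ i≡a′ j≡b′) d<N)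

    newLabel-last : ∀ i j → diag i j ≡ lastDiag → newLabel S i j ≡ nothing
    newLabel-last i j d≡N with getM-rightOf i j | getM-below i j
    ... | inj₂ (r , _) | inj₂ (u , _) rewrite r | u = refl
    ... | inj₁ (_ , j<b′) | _ = ⊥-elim (<-irrefl d≡N (+-mono-≤-< (toℕ≤a′ i) j<b′))
    ... | _ | inj₁ (_ , i<a′) = ⊥-elim (<-irrefl d≡N (+-mono-<-≤ i<a′ (toℕ≤b′ j)))

    unclaimed : ∀ i j v → (∀ k → suc k ≡ diag i j → Labelled (g k)) → claimed S i j v ≡ false
    unclaimed i j v labelled = cong₂ _∨_ (fromLeft j labelled) (fromAbove i labelled)
      where
      notTaken : ∀ {i′ j′} → Labelled (g (diag i′ j′)) → takesFrom S (just (i′ , j′)) v ≡ false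
      notTaken {i′} {j′} (x , gx) = takesFrom-labelled S i′ j′ (trans (onDiag D i′ j′) gx)
      fromLeft : ∀ j → (∀ k → suc k ≡ diag i j → Labelled (g k)) → takesFrom S (leftOf i j) v ≡ false
      fromLeft zero    _        = refl
      fromLeft (suc j) labelled = notTaken (labelled _ (diag-left i j))
      fromAbove : ∀ i → (∀ k → suc k ≡ diag i j → Labelled (g k)) → takesFrom S (above i j) v ≡ false
      fromAbove zero    _        = refl
      fromAbove (suc i) labelled = notTaken (labelled _ (diag-above i j))

    step-keeps-label : ∀ i j {v} → g (diag i j) ≡ just v → (∀ k → suc k ≡ diag i j → Labelled (g k)) →
      get (step S) i j ≡ just v
    step-keeps-label i j {v} gv labelled = trans (get-step-labelled S i j (trans (onDiag D i j) gv))
      (cong (λ c → if c then nothing else just v) (unclaimed i j v labelled))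

    vacancy-takes : ∀ {i′ j′ d k w} → suc (diag i′ j′) ≡ d → d ≤ lastDiag → suc k ≡ d →
      g k ≡ nothing → g d ≡ just w → takesFrom S (just (i′ , j′)) w ≡ true
    vacancy-takes {i′} {j′} e d≤N e′ gk gw = takesFrom-empty S i′ j′
      (trans (onDiag D i′ j′) (trans (cong g (suc-injective (trans e (sym e′)))) gk))
      (trans (newLabel-inner i′ j′ (subst (_≤ lastDiag) (sym e) d≤N)) (trans (cong g e) gw))

    claimed-after-hole : ∀ i j {k w} → g k ≡ nothing → suc k ≡ diag i j → g (diag i j) ≡ just w →
      claimed S i j w ≡ true
    claimed-after-hole i (suc j) {w = w} gk e gw =
      cong (_∨ takesFrom S (above i (suc j)) w) (vacancy-takes (diag-left i j) (diag≤lastDiag i (suc j)) e gk gw)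
    claimed-after-hole (suc i) zero gk e gw =
      vacancy-takes (diag-above i zero) (diag≤lastDiag (suc i) zero) e gk gw
    claimed-after-hole zero zero gk () gw

  Diagonal-cong : ∀ {S g g′} → (∀ d → g d ≡ g′ d) → Diagonal S g → Diagonal S g′
  Diagonal-cong eq D .onDiag i j = trans (onDiag D i j) (eq _)

  -- One step moves the hole from antidiagonal n to n+1: the empty cells take the labels
  -- of antidiagonal n+1, which are in turn removed there, and nothing else moves.
  step-slides-hole : ∀ {S f n} → n < lastDiag → Diagonal S (holeAt f n) → Diagonal (step S) (holeAt f (suc n))
  step-slides-hole {S} {f} {n} n<N D .onDiag i j = byPosition (<-cmp (diag i j) n)
    where
    open ≡-Reasoning
    afterHole : n < diag i j → Dec (diag i j ≡ suc n) → get (step S) i j ≡ holeAt f (suc n) (diag i j)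
    byPosition : Tri (diag i j < n) (diag i j ≡ n) (n < diag i j) →
      get (step S) i j ≡ holeAt f (suc n) (diag i j)
    byPosition (tri< d<n _ _) =
      trans (step-keeps-label D i j (holeAt-< f d<n) (holeAt-before-labelled f (<⇒≢ (m<n⇒m<1+n d<n))))
            (sym (holeAt-< f (m<n⇒m<1+n d<n)))
    byPosition (tri≈ _ d≡n _) = begin
      get (step S) i j             ≡⟨ get-step-empty S i j (trans (onDiag D i j) hole) ⟩
      newLabel S i j               ≡⟨ newLabel-inner D i j (subst (_< lastDiag) (sym d≡n) n<N) ⟩
      holeAt f n (suc (diag i j))  ≡⟨ cong (λ d → holeAt f n (suc d)) d≡n ⟩
      holeAt f n (suc n)           ≡⟨ holeAt-> f (n<1+n n) ⟩
      just (f (suc n))             ≡⟨ holeAt-< f (n<1+n n) ⟨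
      holeAt f (suc n) n           ≡⟨ cong (holeAt f (suc n)) d≡n ⟨
      holeAt f (suc n) (diag i j)  ∎
      where
      hole : holeAt f n (diag i j) ≡ nothing
      hole = trans (cong (holeAt f n) d≡n) (holeAt-self f n)
    byPosition (tri> _ _ n<d) = afterHole n<d (diag i j ≟ suc n)
    afterHole n<d (yes d≡1+n) = begin
      get (step S) i j                 ≡⟨ get-step-labelled S i j (trans (onDiag D i j) (holeAt-> f n<d)) ⟩
      (if claimed S i j (f (diag i j)) then nothing else just (f (diag i j)))
        ≡⟨ cong (λ c → if c then nothing else just (f (diag i j)))
                (claimed-after-hole D i j (holeAt-self f n) (sym d≡1+n) (holeAt-> f n<d)) ⟩
      nothing                          ≡⟨ holeAt-self f (suc n) ⟨
      holeAt f (suc n) (suc n)         ≡⟨ cong (holeAt f (suc n)) d≡1+n ⟨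
      holeAt f (suc n) (diag i j)      ∎
    afterHole n<d (no d≢1+n) = trans (step-keeps-label D i j (holeAt-> f n<d) (holeAt-before-labelled f d≢1+n))
                                 (sym (holeAt-> f (≤∧≢⇒< n<d (λ e → d≢1+n (sym e)))))

  step-settled : ∀ {S g} → (∀ k → k < lastDiag → Labelled (g k)) → Diagonal S g → Diagonal (step S) g
  step-settled {S} {g} labelled D .onDiag i j = byLabel (g (diag i j)) refl
    where
    byLabel : ∀ y → g (diag i j) ≡ y → get (step S) i j ≡ g (diag i j)
    byLabel (just v) gv = trans (step-keeps-label D i j gv before) (sym gv)
      where
      before : ∀ k → suc k ≡ diag i j → Labelled (g k)
      before k e = labelled k (subst (_≤ lastDiag) (sym e) (diag≤lastDiag i j))
    byLabel nothing gn with m≤n⇒m<n∨m≡n (diag≤lastDiag i j)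
    ... | inj₁ d<N with labelled _ d<N
    ...   | x , gx with trans (sym gx) gn
    ...     | ()
    byLabel nothing gn | inj₂ d≡N =
      trans (get-step-empty S i j (trans (onDiag D i j) gn)) (trans (newLabel-last D i j d≡N) (sym gn))

  iterate-slides : ∀ {S f} → Diagonal S (holeAt f 0) → ∀ k → k ≤ lastDiag →
    Diagonal (iter step k S) (holeAt f k)
  iterate-slides D zero    _   = D
  iterate-slides D (suc k) k<N = step-slides-hole k<N (iterate-slides D k (<⇒≤ k<N))

  iterate-settled : ∀ {S g} → (∀ k → k < lastDiag → Labelled (g k)) → Diagonal S g →
    ∀ k → Diagonal (iter step k S) g
  iterate-settled labelled D zero    = D
  iterate-settled labelled D (suc k) = step-settled labelled (iterate-settled labelled D k)

  diagonalTab : (ℕ → ℕ) → Tab a b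
  diagonalTab f = Vec.tabulate λ i → Vec.tabulate λ j → f (diag i j)

  diagonalTab-entry : ∀ f i j → entry (diagonalTab f) i j ≡ f (diag i j)
  diagonalTab-entry f = lookup-tabulate² (λ i j → f (diag i j))

  initialState-diagonalTab : ∀ f → Diagonal (initialState (diagonalTab f)) (λ d → unlabelOne (f d))
  initialState-diagonalTab f .onDiag i j =
    trans (lookup-map² unlabelOne (diagonalTab f) i j) (cong unlabelOne (diagonalTab-entry f i j))

  KPro-diagonalTab-with-1 : ∀ f → f 0 ≡ 1 → (∀ d → 2 ≤ f (suc d)) → ∀ i j →
    entry (KPro m (diagonalTab f)) i j ≡ finalLabel m (holeAt f lastDiag (diag i j))
  KPro-diagonalTab-with-1 f f0≡1 f≥2 i j = trans (KPro-entry m _ i j) (cong (finalLabel m) (onDiag final i j))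
    where
    initial : ∀ d → unlabelOne (f d) ≡ holeAt f 0 d
    initial zero    rewrite f0≡1 = sym (holeAt-self f 0)
    initial (suc d) = trans (unlabelOne-≥2 (f≥2 d)) (sym (holeAt-> f (s≤s z≤n)))
    final : Diagonal (iter step m (initialState (diagonalTab f))) (holeAt f lastDiag)
    final = subst (λ k → Diagonal (iter step k (initialState (diagonalTab f))) (holeAt f lastDiag))
      (sym m≡2+lastDiag) (iterate-settled (λ k k<N → _ , holeAt-< f k<N)
        (iterate-slides (Diagonal-cong initial (initialState-diagonalTab f)) lastDiag ≤-refl) 2)

  KPro-diagonalTab-without-1 : ∀ f → (∀ d → 2 ≤ f d) → ∀ i j →
    entry (KPro m (diagonalTab f)) i j ≡ f (diag i j) ∸ 1
  KPro-diagonalTab-without-1 f f≥2 i j = trans (KPro-entry m _ i j) (cong (finalLabel m) (onDiag final i j))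
    where
    final : Diagonal (iter step m (initialState (diagonalTab f))) (λ d → just (f d))
    final = iterate-settled (λ k _ → _ , refl)
      (Diagonal-cong (λ d → unlabelOne-≥2 (f≥2 d)) (initialState-diagonalTab f)) m

  Gap : ℕ → Tab a b
  Gap c = diagonalTab (skipping c)

  Gap-entry : ∀ c i j → entry (Gap c) i j ≡ skipping c (diag i j)
  Gap-entry c = diagonalTab-entry (skipping c)

  T₀≡Gap-m : T₀ a b ≡ Gap m
  T₀≡Gap-m = entry-ext λ i j → begin
    entry (T₀ a b) i j        ≡⟨ lookup-tabulate² (λ i j → diag i j + 1) i j ⟩
    diag i j + 1              ≡⟨ +-comm (diag i j) 1 ⟩
    suc (diag i j)            ≡⟨ skipping-below (1+diag<m i j) ⟨
    skipping m (diag i j)     ≡⟨ Gap-entry m i j ⟨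
    entry (Gap m) i j         ∎
    where open ≡-Reasoning

  KPro-Gap-suc : ∀ {c} → 1 ≤ c → suc c ≤ m → KPro m (Gap (suc c)) ≡ Gap c
  KPro-Gap-suc {c} 1≤c 1+c≤m = entry-ext λ i j → trans (KPro-diagonalTab-with-1 (skipping (suc c))
      (skipping-below (s≤s 1≤c)) (λ d → ≤-trans (s≤s (s≤s z≤n)) (skipping-lower (suc c) (suc d))) i j)
    (trans (byPosition i j (m≤n⇒m<n∨m≡n (diag≤lastDiag i j))) (sym (Gap-entry c i j)))
    where
    byPosition : ∀ i j → diag i j < lastDiag ⊎ diag i j ≡ lastDiag →
      finalLabel m (holeAt (skipping (suc c)) lastDiag (diag i j)) ≡ skipping c (diag i j)
    byPosition i j (inj₁ d<N) rewrite holeAt-< (skipping (suc c)) d<N =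
      cong (_∸ 1) (skipping-suc c (diag i j))
    byPosition i j (inj₂ d≡N) rewrite d≡N | holeAt-self (skipping (suc c)) lastDiag = begin
      m                         ≡⟨ m≡2+lastDiag ⟩
      suc (suc lastDiag)        ≡⟨ skipping-above (≤-pred (subst (suc c ≤_) m≡2+lastDiag 1+c≤m)) ⟨
      skipping c lastDiag       ∎
      where open ≡-Reasoning

  KPro-Gap-1 : KPro m (Gap 1) ≡ Gap m
  KPro-Gap-1 = entry-ext λ i j → begin
    entry (KPro m (Gap 1)) i j    ≡⟨ KPro-diagonalTab-without-1 (skipping 1) 2≤skipping-1 i j ⟩
    skipping 1 (diag i j) ∸ 1     ≡⟨ cong (_∸ 1) (skipping-above (s≤s z≤n)) ⟩
    suc (diag i j)                ≡⟨ skipping-below (1+diag<m i j) ⟨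
    skipping m (diag i j)         ≡⟨ Gap-entry m i j ⟨
    entry (Gap m) i j             ∎
    where
    open ≡-Reasoning
    2≤skipping-1 : ∀ d → 2 ≤ skipping 1 d
    2≤skipping-1 d = ≤-trans (s≤s (s≤s z≤n)) (≤-reflexive (sym (skipping-above (s≤s z≤n))))

  iterate-KPro-Gap : ∀ k → ∃[ c ] 1 ≤ c × c ≤ m × iter (KPro m) k (T₀ a b) ≡ Gap c
  iterate-KPro-Gap zero = m , s≤s z≤n , ≤-refl , T₀≡Gap-m
  iterate-KPro-Gap (suc k) with iterate-KPro-Gap k
  ... | suc zero , _ , _ , eq = m , s≤s z≤n , ≤-refl , trans (cong (KPro m) eq) KPro-Gap-1
  ... | suc (suc c) , _ , 2+c≤m , eq =
    suc c , s≤s z≤n , <⇒≤ 2+c≤m , trans (cong (KPro m) eq) (KPro-Gap-suc (s≤s z≤n) 2+c≤m)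

  iterate-KPro-Gap-< : ∀ k → k < m → iter (KPro m) k (T₀ a b) ≡ Gap (m ∸ k)
  iterate-KPro-Gap-< zero    _   = T₀≡Gap-m
  iterate-KPro-Gap-< (suc k) 1+k<m = begin
    KPro m (iter (KPro m) k (T₀ a b))  ≡⟨ cong (KPro m) (iterate-KPro-Gap-< k (<-trans (n<1+n k) 1+k<m)) ⟩
    KPro m (Gap (m ∸ k))               ≡⟨ cong (λ c → KPro m (Gap c)) m∸k≡1+m∸1+k ⟩
    KPro m (Gap (suc (m ∸ suc k)))
      ≡⟨ KPro-Gap-suc (m<n⇒0<n∸m 1+k<m) (subst (_≤ m) m∸k≡1+m∸1+k (m∸n≤m m k)) ⟩
    Gap (m ∸ suc k)                    ∎
    where
    open ≡-Reasoning
    m∸k≡1+m∸1+k : m ∸ k ≡ suc (m ∸ suc k)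
    m∸k≡1+m∸1+k = +-∸-assoc 1 (<⇒≤ (≤-pred 1+k<m))

  InOrbit⇔Gap : ∀ T → InOrbit a b T ⇔ (∃[ c ] 1 ≤ c × c ≤ m × T ≡ Gap c)
  InOrbit⇔Gap T = mk⇔ to from
    where
    to : InOrbit a b T → ∃[ c ] 1 ≤ c × c ≤ m × T ≡ Gap c
    to (k , eq) with iterate-KPro-Gap k
    ... | c , 1≤c , c≤m , eq′ = c , 1≤c , c≤m , trans (sym eq) eq′
    from : ∃[ c ] 1 ≤ c × c ≤ m × T ≡ Gap c → InOrbit a b T
    from (c , 1≤c , c≤m , eq) = m ∸ c , (begin
      iter (KPro m) (m ∸ c) (T₀ a b)    ≡⟨ iterate-KPro-Gap-< (m ∸ c) (∸-monoʳ-< 1≤c c≤m) ⟩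
      Gap (m ∸ (m ∸ c))                 ≡⟨ cong Gap (m∸[m∸n]≡n c≤m) ⟩
      Gap c                             ≡⟨ eq ⟨
      T                                 ∎)
      where open ≡-Reasoning

  Gap-IsInc : ∀ c → IsInc m (Gap c)
  Gap-IsInc c = bounds , rows , columns
    where
    bounds : ∀ i j → 1 ≤ entry (Gap c) i j × entry (Gap c) i j ≤ m
    bounds i j rewrite Gap-entry c i j =
      ≤-trans (s≤s z≤n) (skipping-lower c _) , ≤-trans (skipping-upper c _) (1+diag<m i j)
    rows : ∀ i j j′ → toℕ j < toℕ j′ → entry (Gap c) i j < entry (Gap c) i j′
    rows i j j′ j<j′ rewrite Gap-entry c i j | Gap-entry c i j′ =
      skipping-strictMono c (+-monoʳ-< (toℕ i) j<j′)
    columns : ∀ i i′ j → toℕ i < toℕ i′ → entry (Gap c) i j < entry (Gap c) i′ j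
    columns i i′ j i<i′ rewrite Gap-entry c i j | Gap-entry c i′ j =
      skipping-strictMono c (+-monoˡ-< (toℕ j) i<i′)

  Gap-≢ : ∀ {c c′} → 1 ≤ c → c < c′ → c′ ≤ m → Gap c ≢ Gap c′
  Gap-≢ {suc d} {c′} _ c<c′ c′≤m eq with diag-surjective d≤N
    where
    d≤N : d ≤ lastDiag
    d≤N = ≤-pred (≤-pred (subst (suc (suc d) ≤_) m≡2+lastDiag (≤-trans c<c′ c′≤m)))
  ... | i , j , diag≡d = 1+n≢n (begin
    suc (suc d)                   ≡⟨ skipping-above ≤-refl ⟨
    skipping (suc d) d            ≡⟨ cong (skipping (suc d)) diag≡d ⟨
    skipping (suc d) (diag i j)   ≡⟨ Gap-entry (suc d) i j ⟨
    entry (Gap (suc d)) i j       ≡⟨ cong (λ U → entry U i j) eq ⟩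
    entry (Gap c′) i j            ≡⟨ Gap-entry c′ i j ⟩
    skipping c′ (diag i j)        ≡⟨ cong (skipping c′) diag≡d ⟩
    skipping c′ d                 ≡⟨ skipping-below c<c′ ⟩
    suc d                         ∎)
    where open ≡-Reasoning

  Gap-injective : ∀ {c c′} → 1 ≤ c → c ≤ m → 1 ≤ c′ → c′ ≤ m → Gap c ≡ Gap c′ → c ≡ c′
  Gap-injective {c} {c′} 1≤c c≤m 1≤c′ c′≤m eq with <-cmp c c′
  ... | tri< c<c′ _ _ = ⊥-elim (Gap-≢ 1≤c c<c′ c′≤m eq)
  ... | tri≈ _ c≡c′ _ = c≡c′
  ... | tri> _ _ c′<c = ⊥-elim (Gap-≢ 1≤c′ c′<c c≤m (sym eq))

  orbitGap : Fin m → Tab a b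
  orbitGap k = Gap (suc (toℕ k))

  orbitList : List (Tab a b)
  orbitList = tabulate orbitGap

  orbitList-unique : Unique orbitList
  orbitList-unique = tabulate⁺ λ {k} {k′} eq →
    toℕ-injective (suc-injective (Gap-injective (s≤s z≤n) (toℕ<n k) (s≤s z≤n) (toℕ<n k′) eq))

  orbitList-length : length orbitList ≡ m
  orbitList-length = length-tabulate orbitGap

  ∈-orbitList⇔InOrbit : ∀ T → T ∈ orbitList ⇔ InOrbit a b T
  ∈-orbitList⇔InOrbit T = mk⇔ to from
    where
    to : T ∈ orbitList → InOrbit a b T
    to T∈ with ∈-tabulate⁻ {f = orbitGap} T∈
    ... | k , eq = Equivalence.from (InOrbit⇔Gap T) (suc (toℕ k) , s≤s z≤n , toℕ<n k , eq)
    from : InOrbit a b T → T ∈ orbitList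
    from orb with Equivalence.to (InOrbit⇔Gap T) orb
    ... | suc c , _ , c<m , eq =
      subst (_∈ orbitList) (trans (cong (λ c → Gap (suc c)) (toℕ-fromℕ< c<m)) (sym eq))
        (∈-tabulate⁺ {f = orbitGap} (fromℕ< c<m))

  maxEntry-Gap-m<m : maxEntry (Gap m) < m
  maxEntry-Gap-m<m =
    ≤-<-trans (maxEntry-lub (Gap m) entry≤) (subst (suc lastDiag <_) (sym m≡2+lastDiag) ≤-refl)
    where
    entry≤ : ∀ i j → entry (Gap m) i j ≤ suc lastDiag
    entry≤ i j rewrite Gap-entry m i j | skipping-below (1+diag<m i j) = s≤s (diag≤lastDiag i j)

  Gap-not-packed : ∀ {c} → 1 ≤ c → c ≤ m → ¬ IsPackedInc m (Gap c)
  Gap-not-packed {c} 1≤c c≤m (_ , packed , max≡m) with m≤n⇒m<n∨m≡n c≤m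
  ... | inj₂ refl = <-irrefl max≡m maxEntry-Gap-m<m
  ... | inj₁ c<m with packed c 1≤c (subst (c ≤_) (sym max≡m) (<⇒≤ c<m))
  ...   | i , j , eq = skipping-≢ c (diag i j) (trans (sym (Gap-entry c i j)) eq)

  module Increasing {T : Tab a b} (inc : IsInc m T) where

    rowInc : ∀ i j j′ → toℕ j < toℕ j′ → entry T i j < entry T i j′
    rowInc = proj₁ (proj₂ inc)

    colInc : ∀ i i′ j → toℕ i < toℕ i′ → entry T i j < entry T i′ j
    colInc = proj₂ (proj₂ inc)

    entry-+-≤ : ∀ {i i′ j j′} p q → toℕ i′ ≡ toℕ i + p → toℕ j′ ≡ toℕ j + q →
      entry T i j + (p + q) ≤ entry T i′ j′
    entry-+-≤ {i} {i′} {j} {j′} p q i′≡i+p j′≡j+q = begin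
      entry T i j + (p + q)   ≡⟨ cong (entry T i j +_) (+-comm p q) ⟩
      entry T i j + (q + p)   ≡⟨ +-assoc (entry T i j) q p ⟨
      entry T i j + q + p     ≤⟨ +-monoˡ-≤ p (increasing⇒+-≤ (entry T i) (rowInc i) q j′≡j+q) ⟩
      entry T i j′ + p        ≤⟨ increasing⇒+-≤ (λ x → entry T x j′) (λ x y → colInc x y j′) p i′≡i+p ⟩
      entry T i′ j′           ∎
      where open ≤-Reasoning

    entry-lower : ∀ i j → suc (diag i j) ≤ entry T i j
    entry-lower i j = ≤-trans (+-monoˡ-≤ (diag i j) (proj₁ (proj₁ inc zero zero)))
                              (entry-+-≤ {zero} {i} {zero} {j} (toℕ i) (toℕ j) refl refl)

    entry-upper : ∀ i j → entry T i j ≤ suc (suc (diag i j))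
    entry-upper i j = +-cancelʳ-≤ (p + q) (entry T i j) (suc (suc (diag i j))) (begin
      entry T i j + (p + q)                  ≤⟨ entry-+-≤ p q (sym i+p≡a′) (sym j+q≡b′) ⟩
      entry T (fromℕ a′) (fromℕ b′)          ≤⟨ proj₂ (proj₁ inc (fromℕ a′) (fromℕ b′)) ⟩
      m                                      ≡⟨ m≡2+lastDiag ⟩
      suc (suc (a′ + b′))                    ≡⟨ cong₂ (λ x y → suc (suc (x + y))) (sym (m+[n∸m]≡n (toℕ≤a′ i)))
                                                                                   (sym (m+[n∸m]≡n (toℕ≤b′ j))) ⟩
      suc (suc ((toℕ i + p) + (toℕ j + q)))  ≡⟨ solve 4 (λ x y z w → con 2 :+ ((x :+ z) :+ (y :+ w))
                                                                   := (con 2 :+ (x :+ y)) :+ (z :+ w))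
                                                        refl (toℕ i) (toℕ j) p q ⟩
      suc (suc (diag i j)) + (p + q)         ∎)
      where
      open ≤-Reasoning
      open +-*-Solver
      p = a′ ∸ toℕ i
      q = b′ ∸ toℕ j
      i+p≡a′ : toℕ i + p ≡ toℕ (fromℕ a′)
      i+p≡a′ = trans (m+[n∸m]≡n (toℕ≤a′ i)) (sym (toℕ-fromℕ a′))
      j+q≡b′ : toℕ j + q ≡ toℕ (fromℕ b′)
      j+q≡b′ = trans (m+[n∸m]≡n (toℕ≤b′ j)) (sym (toℕ-fromℕ b′))

    entry-cases : ∀ i j → entry T i j ≡ suc (diag i j) ⊎ entry T i j ≡ suc (suc (diag i j))
    entry-cases i j with m≤n⇒m<n∨m≡n (entry-upper i j)
    ... | inj₁ T<2+d = inj₁ (≤-antisym (≤-pred T<2+d) (entry-lower i j))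
    ... | inj₂ T≡2+d = inj₂ T≡2+d

    successor-cell : ∀ i j → diag i j < lastDiag →
      ∃[ i′ ] ∃[ j′ ] diag i′ j′ ≡ suc (diag i j) × entry T i j < entry T i′ j′
    successor-cell i j d<N with rightOf-cases i j | below-cases i j
    ... | inj₁ (j′ , _ , j′≡1+j) | _ =
      i , j′ , trans (cong (toℕ i +_) j′≡1+j) (+-suc (toℕ i) (toℕ j)) , rowInc i j j′ (≤-reflexive (sym j′≡1+j))
    ... | inj₂ _ | inj₁ (i′ , _ , i′≡1+i) =
      i′ , j , cong (_+ toℕ j) i′≡1+i , colInc i i′ j (≤-reflexive (sym i′≡1+i))
    ... | inj₂ (_ , b≤1+j) | inj₂ (_ , a≤1+i) = ⊥-elim (<⇒≱ d<N (+-mono-≤ (≤-pred a≤1+i) (≤-pred b≤1+j)))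

    predecessor-cell : ∀ i j → 0 < diag i j →
      ∃[ i′ ] ∃[ j′ ] suc (diag i′ j′) ≡ diag i j × entry T i′ j′ < entry T i j
    predecessor-cell i (suc j) _ =
      i , inject₁ j , diag-left i j , rowInc i (inject₁ j) (suc j) (s≤s (≤-reflexive (toℕ-inject₁ j)))
    predecessor-cell (suc i) zero _ =
      inject₁ i , zero , diag-above i zero , colInc (inject₁ i) (suc i) zero (s≤s (≤-reflexive (toℕ-inject₁ i)))

    upper-label-spreads : ∀ k i j → entry T i j ≡ suc (suc (diag i j)) → suc (suc (diag i j)) + k ≤ m →
      Occurs T (suc (suc (diag i j)) + k)
    upper-label-spreads zero i j high _ = i , j , trans high (sym (+-identityʳ _))
    upper-label-spreads (suc k) i j high bound with successor-cell i j d<N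
      where
      d<N : diag i j < lastDiag
      d<N = ≤-trans (m≤m+n (suc (diag i j)) k)
        (≤-pred (≤-pred (subst₂ _≤_ (+-suc (suc (suc (diag i j))) k) m≡2+lastDiag bound)))
    ... | i′ , j′ , diag′≡1+d , T<T′ =
      subst (Occurs T) shift (upper-label-spreads k i′ j′ high′ (subst (_≤ m) (sym shift) bound))
      where
      shift : suc (suc (diag i′ j′)) + k ≡ suc (suc (diag i j)) + suc k
      shift = trans (cong (λ d → suc (suc d) + k) diag′≡1+d) (sym (+-suc (suc (suc (diag i j))) k))
      high′ : entry T i′ j′ ≡ suc (suc (diag i′ j′))
      high′ = ≤-antisym (entry-upper i′ j′)
        (subst (λ d → suc (suc d) ≤ entry T i′ j′) (sym diag′≡1+d) (subst (_< entry T i′ j′) high T<T′))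

    lower-label-spreads : ∀ k i j → entry T i j ≡ suc (diag i j) → ∀ {v} → 1 ≤ v → v + k ≡ suc (diag i j) →
      Occurs T v
    lower-label-spreads zero i j low {v} _ eq = i , j , trans low (trans (sym eq) (+-identityʳ v))
    lower-label-spreads (suc k) i j low {v} 1≤v eq with predecessor-cell i j 0<d
      where
      0<d : 0 < diag i j
      0<d = ≤-trans 1≤v (≤-trans (m≤m+n v k) (≤-reflexive (suc-injective (trans (sym (+-suc v k)) eq))))
    ... | i′ , j′ , 1+diag′≡d , T′<T = lower-label-spreads k i′ j′ low′ 1≤v
      (suc-injective (trans (sym (+-suc v k)) (trans eq (cong suc (sym 1+diag′≡d)))))
      where
      low′ : entry T i′ j′ ≡ suc (diag i′ j′)
      low′ = ≤-antisym (≤-pred (subst (entry T i′ j′ <_) (trans low (cong suc (sym 1+diag′≡d))) T′<T))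
                       (entry-lower i′ j′)

    missing⇒Gap : ∀ {v} → 1 ≤ v → v ≤ m → ¬ Occurs T v → T ≡ Gap v
    missing⇒Gap {v} 1≤v v≤m missing = entry-ext λ i j →
      trans (byCase i j (v ≤? suc (diag i j)) (entry-cases i j)) (sym (Gap-entry v i j))
      where
      byCase : ∀ i j → Dec (v ≤ suc (diag i j)) →
        entry T i j ≡ suc (diag i j) ⊎ entry T i j ≡ suc (suc (diag i j)) → entry T i j ≡ skipping v (diag i j)
      byCase i j (yes v≤1+d) (inj₁ low) =
        ⊥-elim (missing (lower-label-spreads (suc (diag i j) ∸ v) i j low 1≤v (m+[n∸m]≡n v≤1+d)))
      byCase i j (yes v≤1+d) (inj₂ high) = trans high (sym (skipping-above v≤1+d))
      byCase i j (no v≰1+d) (inj₁ low) = trans low (sym (skipping-below (≰⇒> v≰1+d)))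
      byCase i j (no v≰1+d) (inj₂ high) = ⊥-elim (missing (subst (Occurs T) (m+[n∸m]≡n 2+d≤v)
        (upper-label-spreads (v ∸ suc (suc (diag i j))) i j high (subst (_≤ m) (sym (m+[n∸m]≡n 2+d≤v)) v≤m))))
        where
        2+d≤v : suc (suc (diag i j)) ≤ v
        2+d≤v = ≰⇒> v≰1+d

    occurs? : ∀ v → Dec (Occurs T v)
    occurs? v = any? λ i → any? λ j → entry T i j ≟ v

    packed-or-Gap : IsPackedInc m T ⊎ ∃[ v ] 1 ≤ v × v ≤ m × T ≡ Gap v
    packed-or-Gap with all? (λ (k : Fin m) → occurs? (suc (toℕ k)))
    ... | yes allOccur = inj₁ (inc , (λ v 1≤v v≤max → occurs v 1≤v (subst (v ≤_) max≡m v≤max)) , max≡m)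
      where
      occurs : ∀ v → 1 ≤ v → v ≤ m → Occurs T v
      occurs (suc v) _ 1+v≤m = subst (λ k → Occurs T (suc k)) (toℕ-fromℕ< 1+v≤m) (allOccur (fromℕ< 1+v≤m))
      max≡m : maxEntry T ≡ m
      max≡m with occurs m (s≤s z≤n) ≤-refl
      ... | i , j , T≡m = ≤-antisym (maxEntry-lub T (λ i j → proj₂ (proj₁ inc i j)))
                                    (subst (_≤ maxEntry T) T≡m (entry≤maxEntry T i j))
    ... | no notAll with ¬∀⟶∃¬ m _ (λ k → occurs? (suc (toℕ k))) notAll
    ...   | k , missing = inj₂ (suc (toℕ k) , s≤s z≤n , toℕ<n k , missing⇒Gap (s≤s z≤n) (toℕ<n k) missing)

  IsInc⇔packed⊎InOrbit : ∀ T → IsInc m T ⇔ (IsPackedInc m T ⊎ InOrbit a b T)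
  IsInc⇔packed⊎InOrbit T = mk⇔ to from
    where
    to : IsInc m T → IsPackedInc m T ⊎ InOrbit a b T
    to inc = map₂ (Equivalence.from (InOrbit⇔Gap T)) (Increasing.packed-or-Gap inc)
    from : IsPackedInc m T ⊎ InOrbit a b T → IsInc m T
    from (inj₁ packed) = proj₁ packed
    from (inj₂ orb) with Equivalence.to (InOrbit⇔Gap T) orb
    ... | c , _ , _ , refl = Gap-IsInc c

  packed⇒¬InOrbit : ∀ T → IsPackedInc m T → ¬ InOrbit a b T
  packed⇒¬InOrbit T packed orb with Equivalence.to (InOrbit⇔Gap T) orb
  ... | c , 1≤c , c≤m , refl = Gap-not-packed 1≤c c≤m packed

lemma3p3 : (a b : ℕ) → 1 ≤ a → 1 ≤ b →
    ((T : Tab a b) → IsInc (a + b) T ⇔ (IsPackedInc (a + b) T ⊎ InOrbit a b T))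
    × ((T : Tab a b) → IsPackedInc (a + b) T → ¬ InOrbit a b T)
    × (∃[ L ] (Unique L × length L ≡ a + b × ((T : Tab a b) → T ∈ L ⇔ InOrbit a b T)))
lemma3p3 (suc a′) (suc b′) (s≤s z≤n) (s≤s z≤n) =
  IsInc⇔packed⊎InOrbit , packed⇒¬InOrbit ,
  orbitList , orbitList-unique , orbitList-length , ∈-orbitList⇔InOrbit
  where open Rectangle a′ b′
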